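{- Let $X$ be a finite alphabet and $u,v\in X^*$. If $\mathrm{hypo}(\mathcal{C}_2)$ satisfies the identity $u=v$, then: (1) $|u|_x=|v|_x$ for all $x\in X$; (2) for each $x\in X$, if $u=u_1xu_2$ and $v=v_1xv_2$ with $u_1,u_2,v_1,v_2\in X^*$ and $|u_1|_x=|v_1|_x=0$, then $|u_1|_y=|v_1|_y$ for all $y\in X$; (3) for each $x\in X$, if $u=u_1xu_2$ and $v=v_1xv_2$ with $u_1,u_2,v_1,v_2\in X^*$ and $|u_2|_x=|v_2|_x=0$, then $|u_2|_y=|v_2|_y$ for all $y\in X$.
   Context: $|w|_a$ denotes the number of occurrences of the letter $a$ in the word $w$. A monoid $M$ satisfies the identity $u=v$ ($u,v\in X^*$) if $\phi(u)=\phi(v)$ for every monoid homomorphism $\phi:X^*\to M$. Let $C_2=\{1<2<\bar2<\bar1\}$ and $C_2^*$ the free monoid over it; the symbol $3$ and $\bar3$ never occur. For $i\in\{1,2\}$, $w$ has an $i$-inversion if $w=w_1xw_2yw_3$ with $x\in\{i,\overline{i+1}\}$, $y\in\{i+1,\bar i\}$ (so a $2$-inversion means $w=w_12w_2\bar2w_3$). Quasi-crystal structure on $C_2^*$: $\mathrm{wt}(w)=(|w|_1-|w|_{\bar1},|w|_2-|w|_{\bar2})$. For $i\in\{1,2\}$: if $w$ has an $i$-inversion then $\ddot{\varepsilon}_i(w)=\ddot{\varphi}_i(w)=+\infty$ and $\ddot{e}_i(w),\ddot{f}_i(w)$ are undefined; otherwise $\ddot{\varepsilon}_i(w)=|w|_{i+1}+|w|_{\bar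 i}$, $\ddot{\varphi}_i(w)=|w|_i+|w|_{\overline{i+1}}$; $\ddot{e}_i(w)$ is defined iff $\ddot{\varepsilon}_i(w)>0$ and is obtained by replacing the right-most letter of $w$ in $\{i+1,\bar i\}$ by its image ($\ddot{e}_1:2\mapsto1,\bar1\mapsto\bar2$; $\ddot{e}_2:\bar2\mapsto2$); $\ddot{f}_i(w)$ is defined iff $\ddot{\varphi}_i(w)>0$ and is obtained by replacing the left-most letter of $w$ in $\{i,\overline{i+1}\}$ by its image ($\ddot{f}_1:1\mapsto2,\bar2\mapsto\bar1$; $\ddot{f}_2:2\mapsto\bar2$). The connected component $C_2^*(w)$ is the set of words obtained from $w$ by finitely many (defined) applications of these operators. Hypoplactic congruence: $u\ddot{\sim}v$ iff there is a bijection $\psi:C_2^*(u)\to C_2^*(v)$ with $\psi(u)=v$ preserving $\mathrm{wt},\ddot{\varepsilon}_i,\ddot{\varphi}_i$ and such that $\ddot{e}_i(\psi(x))$ is defined iff $\ddot{e}_i(x)$ is (then $\psi(\ddot{e}_i(x))=\ddot{e}_i(\psi(x))$), likewise for $\ddot{f}_i$. It is a monoid congruence; $\mathrm{hypo}(\mathcal{C}_2)=C_2^*/\ddot{\sim}$. -}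

module Defs where

open import Data.Nat using (ℕ; zero; suc; _+_; _>_)
open import Data.Integer using (ℤ; +_; _-_)
open import Data.Fin using (Fin)
open import Data.Bool using (Bool; true; false; if_then_else_; _∨_; _∧_; not)
open import Data.List using (List; []; _∷_; _++_; concatMap)
open import Data.Maybe using (Maybe; just; nothing; map)
open import Data.Product using (_×_; _,_; Σ; ∃)
open import Data.Sum using (_⊎_)
open import Relation.Nullary using (yes; no)
open import Relation.Binary.Definitions using (DecidableEquality)
open import Relation.Binary.PropositionalEquality using (_≡_; refl)
open import Relation.Binary.Construct.Closure.ReflexiveTransitive using (Star)

occ : {A : Set} → DecidableEquality A → A → List A → ℕ
occ _≟_ a [] = 0
occ _≟_ a (b ∷ w) with a ≟ b
... | yes _ = suc (occ _≟_ a w)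
... | no _  = occ _≟_ a w

-- The alphabet C₂ = {1 < 2 < 2̄ < 1̄}

data C2 : Set where
  c1 c2 c2b c1b : C2

_≟C_ : DecidableEquality C2
c1  ≟C c1  = yes refl
c1  ≟C c2  = no λ ()
c1  ≟C c2b = no λ ()
c1  ≟C c1b = no λ ()
c2  ≟C c1  = no λ ()
c2  ≟C c2  = yes refl
c2  ≟C c2b = no λ ()
c2  ≟C c1b = no λ ()
c2b ≟C c1  = no λ ()
c2b ≟C c2  = no λ ()
c2b ≟C c2b = yes refl
c2b ≟C c1b = no λ ()
c1b ≟C c1  = no λ ()
c1b ≟C c2  = no λ ()
c1b ≟C c2b = no λ ()
c1b ≟C c1b = yes refl

Word : Set
Word = List C2

∣_∣C : Word → C2 → ℕ
∣ w ∣C a = occ _≟C_ a w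

data Idx : Set where
  i1 i2 : Idx

data ℕ∞ : Set where
  fin : ℕ → ℕ∞
  ∞   : ℕ∞

-- "left" letters {i, \overline{i+1}} (3̄ never occurs)
isL : Idx → C2 → Bool
isL i1 c1  = true
isL i1 c2b = true
isL i1 _   = false
isL i2 c2  = true
isL i2 _   = false

-- "right" letters {i+1, ī} (3 never occurs)
isR : Idx → C2 → Bool
isR i1 c2  = true
isR i1 c1b = true
isR i1 _   = false
isR i2 c2b = true
isR i2 _   = false

anyR : Idx → Word → Bool
anyR i []      = false
anyR i (x ∷ w) = isR i x ∨ anyR i w

hasInv : Idx → Word → Bool
hasInv i []      = false
hasInv i (x ∷ w) = (isL i x ∧ anyR i w) ∨ hasInv i w

countL : Idx → Word → ℕ
countL i []      = 0
countL i (x ∷ w) = (if isL i x then 1 else 0) + countL i w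

countR : Idx → Word → ℕ
countR i []      = 0
countR i (x ∷ w) = (if isR i x then 1 else 0) + countR i w

wt : Word → ℤ × ℤ
wt w = ((+ ∣ w ∣C c1) - (+ ∣ w ∣C c1b)) , ((+ ∣ w ∣C c2) - (+ ∣ w ∣C c2b))

εq : Idx → Word → ℕ∞
εq i w = if hasInv i w then ∞ else fin (countR i w)

φq : Idx → Word → ℕ∞
φq i w = if hasInv i w then ∞ else fin (countL i w)

eLetter : Idx → C2 → C2
eLetter i1 c2  = c1
eLetter i1 c1b = c2b
eLetter i2 c2b = c2
eLetter _  x   = x

fLetter : Idx → C2 → C2
fLetter i1 c1  = c2
fLetter i1 c2b = c1b
fLetter i2 c2  = c2b
fLetter _  x   = x

replaceRightmostR : Idx → Word → Maybe Word
replaceRightmostR i []      = nothing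
replaceRightmostR i (x ∷ w) with replaceRightmostR i w
... | just w' = just (x ∷ w')
... | nothing = if isR i x then just (eLetter i x ∷ w) else nothing

replaceLeftmostL : Idx → Word → Maybe Word
replaceLeftmostL i []      = nothing
replaceLeftmostL i (x ∷ w) =
  if isL i x then just (fLetter i x ∷ w) else map (x ∷_) (replaceLeftmostL i w)

eq : Idx → Word → Maybe Word
eq i w = if hasInv i w then nothing else replaceRightmostR i w

fq : Idx → Word → Maybe Word
fq i w = if hasInv i w then nothing else replaceLeftmostL i w

Step : Word → Word → Set
Step x y = Σ Idx λ i → (eq i x ≡ just y) ⊎ (fq i x ≡ just y)

InComp : Word → Word → Set
InComp x y = Star Step x y

-- u ∼̈ v : a bijection ψ : C₂*(u) → C₂*(v) (represented as a function on
-- words, whose behaviour outside C₂*(u) is irrelevant) with ψ(u) = v,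
-- preserving wt, ε̈_i, φ̈_i and commuting with ë_i, f̈_i (including definedness).
record HypoIso (u v : Word) (ψ : Word → Word) : Set where
  field
    base    : ψ u ≡ v
    into    : ∀ x → InComp u x → InComp v (ψ x)
    inj     : ∀ x y → InComp u x → InComp u y → ψ x ≡ ψ y → x ≡ y
    surj    : ∀ y → InComp v y → Σ Word λ x → InComp u x × (ψ x ≡ y)
    pres-wt : ∀ x → InComp u x → wt (ψ x) ≡ wt x
    pres-ε  : ∀ i x → InComp u x → εq i (ψ x) ≡ εq i x
    pres-φ  : ∀ i x → InComp u x → φq i (ψ x) ≡ φq i x
    comm-e  : ∀ i x → InComp u x → eq i (ψ x) ≡ map ψ (eq i x)
    comm-f  : ∀ i x → InComp u x → fq i (ψ x) ≡ map ψ (fq i x)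

_∼̈_ : Word → Word → Set
u ∼̈ v = Σ (Word → Word) λ ψ → HypoIso u v ψ

extend : {k : ℕ} → (Fin k → Word) → List (Fin k) → Word
extend σ w = concatMap σ w

-- A homomorphism X* → C₂*/∼̈ is given by choosing a representative word for
-- the image of each letter; it then sends w to the class of extend σ w.
HypoSatisfies : {k : ℕ} → List (Fin k) → List (Fin k) → Set
HypoSatisfies {k} u v = ∀ (σ : Fin k → Word) → extend σ u ∼̈ extend σ v

∣_∣X : {k : ℕ} → List (Fin k) → Fin k → ℕ
∣ w ∣X x = occ Data.Fin._≟_ x w

-- Each condition is read off the images of u and v under a substitution into C₂*.
-- Sending x to 1 and all other letters to the empty word, the first weight
-- coordinate of the image counts x.
-- Sending x to 12̄, y to 2̄ and all other letters to the empty word, the image of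
-- a word is 2̄ᵃ 1 2̄ T with T ∈ {1,2̄}* and a the number of y before the first x;
-- applying f̈₁ turns the 2̄ᵃ into 1̄ᵃ one letter at a time, and the (a+1)-st
-- application creates the first 2-inversion 2 2̄. A quasi-crystal isomorphism
-- commutes with f̈₁ and preserves ε̈₂, which detects 2-inversions, so a is an
-- invariant. The third condition is the mirror image, with x ↦ 21̄, y ↦ 2 and ë₁.
module Submission where

open import Defs
open import Function using (_∘_; const)
open import Data.Nat using (ℕ; zero; suc; _+_; _<_)
open import Data.Nat.Properties using (+-comm; <-cmp; m≤n⇒∃[o]m+o≡n)
open import Data.Integer using (+_)
import Data.Integer.Properties as ℤ
open import Data.Fin using (Fin; _≟_)
open import Data.Bool using (Bool; true; false)
open import Data.Bool.Properties using (¬-not; ∨-zeroʳ; ∧-zeroʳ)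
open import Data.Empty using (⊥)
open import Data.List using (List; []; _∷_; _++_; _∷ʳ_; replicate)
open import Data.List.Properties using (++-assoc; ∷ʳ-++; concatMap-++)
open import Data.List.Relation.Unary.All as All using (All; []; _∷_)
open import Data.List.Relation.Unary.All.Properties using (++⁺; replicate⁺; concat⁺; map⁺)
open import Data.Maybe as Maybe using (Maybe; just; nothing; _>>=_)
open import Data.Product using (_×_; _,_; proj₁)
open import Data.Sum using (inj₁; inj₂)
open import Data.Vec.Functional using (updateAt)
open import Data.Vec.Functional.Properties using (updateAt-updates; updateAt-minimal)
open import Relation.Nullary using (yes; no; contradiction)
open import Relation.Binary.Definitions using (DecidableEquality)
open import Relation.Binary using (tri<; tri≈; tri>)
open import Relation.Binary.PropositionalEquality
  using (_≡_; _≢_; refl; sym; trans; cong; cong₂; subst; module ≡-Reasoning)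
open import Relation.Binary.Construct.Closure.ReflexiveTransitive using (ε; _◅_; _◅◅_)

open ≡-Reasoning

replicate-+ : ∀ {A : Set} m n (x : A) → replicate (m + n) x ≡ replicate m x ++ replicate n x
replicate-+ zero    n x = refl
replicate-+ (suc m) n x = cong (x ∷_) (replicate-+ m n x)

occ-replicate : ∀ {A : Set} (_≟ᴬ_ : DecidableEquality A) a n → occ _≟ᴬ_ a (replicate n a) ≡ n
occ-replicate _≟ᴬ_ a zero = refl
occ-replicate _≟ᴬ_ a (suc n) with a ≟ᴬ a
... | yes _   = cong suc (occ-replicate _≟ᴬ_ a n)
... | no a≢a = contradiction refl a≢a

occ-replicate-≢ : ∀ {A : Set} (_≟ᴬ_ : DecidableEquality A) {a b} n → a ≢ b →
  occ _≟ᴬ_ a (replicate n b) ≡ 0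
occ-replicate-≢ _≟ᴬ_         zero    _   = refl
occ-replicate-≢ _≟ᴬ_ {a} {b} (suc n) a≢b with a ≟ᴬ b
... | yes a≡b = contradiction a≡b a≢b
... | no _    = occ-replicate-≢ _≟ᴬ_ n a≢b

Left Right NotLeft NotRight : Idx → C2 → Set
Left     i c = isL i c ≡ true
Right    i c = isR i c ≡ true
NotLeft  i c = isL i c ≡ false
NotRight i c = isR i c ≡ false

left-right-disjoint : ∀ i c → Left i c → Right i c → ⊥
left-right-disjoint i1 c1  _  ()
left-right-disjoint i1 c2  () _
left-right-disjoint i1 c2b _  ()
left-right-disjoint i1 c1b () _
left-right-disjoint i2 c1  () _
left-right-disjoint i2 c2  _  ()
left-right-disjoint i2 c2b () _
left-right-disjoint i2 c1b () _

left⇒notRight : ∀ i {c} → Left i c → NotRight i c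
left⇒notRight i l = ¬-not (left-right-disjoint i _ l)

right⇒notLeft : ∀ i {c} → Right i c → NotLeft i c
right⇒notLeft i r = ¬-not λ l → left-right-disjoint i _ l r

fLetter-right : ∀ i c → Left i c → Right i (fLetter i c)
fLetter-right i1 c1  _ = refl
fLetter-right i1 c2b _ = refl
fLetter-right i2 c2  _ = refl
fLetter-right i1 c2  ()
fLetter-right i1 c1b ()
fLetter-right i2 c1  ()
fLetter-right i2 c2b ()
fLetter-right i2 c1b ()

eLetter-left : ∀ i c → Right i c → Left i (eLetter i c)
eLetter-left i1 c2  _ = refl
eLetter-left i1 c1b _ = refl
eLetter-left i2 c2b _ = refl
eLetter-left i1 c1  ()
eLetter-left i1 c2b ()
eLetter-left i2 c1  ()
eLetter-left i2 c2  ()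
eLetter-left i2 c1b ()

left₁⇒notLeft₂ : ∀ {c} → Left i1 c → NotLeft i2 c
left₁⇒notLeft₂ {c1}  _ = refl
left₁⇒notLeft₂ {c2b} _ = refl
left₁⇒notLeft₂ {c2}  ()
left₁⇒notLeft₂ {c1b} ()

right₁⇒notRight₂ : ∀ {c} → Right i1 c → NotRight i2 c
right₁⇒notRight₂ {c2}  _ = refl
right₁⇒notRight₂ {c1b} _ = refl
right₁⇒notRight₂ {c1}  ()
right₁⇒notRight₂ {c2b} ()

anyR-notRight : ∀ {i w} → All (NotRight i) w → anyR i w ≡ false
anyR-notRight []       = refl
anyR-notRight (r ∷ rs) rewrite r = anyR-notRight rs

hasInv-notRight : ∀ {i w} → All (NotRight i) w → hasInv i w ≡ false
hasInv-notRight                  []       = refl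
hasInv-notRight {i} {x ∷ _} (_ ∷ rs)
  rewrite anyR-notRight rs | hasInv-notRight rs | ∧-zeroʳ (isL i x) = refl

hasInv-notLeft : ∀ {i w} → All (NotLeft i) w → hasInv i w ≡ false
hasInv-notLeft []       = refl
hasInv-notLeft (l ∷ ls) rewrite l = hasInv-notLeft ls

hasInv-notLeft-++ : ∀ {i P} w → All (NotLeft i) P → hasInv i (P ++ w) ≡ hasInv i w
hasInv-notLeft-++ w []       = refl
hasInv-notLeft-++ w (l ∷ ls) rewrite l = hasInv-notLeft-++ w ls

hasInv-adjacent : ∀ {i x y} P w → Left i x → Right i y → hasInv i (P ++ x ∷ y ∷ w) ≡ true
hasInv-adjacent []      w lx ry rewrite lx | ry = refl
hasInv-adjacent (_ ∷ P) w lx ry rewrite hasInv-adjacent P w lx ry = ∨-zeroʳ _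

εq-hasInv : ∀ {i w w′} → εq i w ≡ εq i w′ → hasInv i w ≡ hasInv i w′
εq-hasInv {i} {w} {w′} e with hasInv i w | hasInv i w′
... | true  | true  = refl
... | false | false = refl
εq-hasInv () | true  | false
εq-hasInv () | false | true

replaceLeftmostL-notLeft : ∀ {i P a} w → All (NotLeft i) P → Left i a →
  replaceLeftmostL i (P ++ a ∷ w) ≡ just (P ++ fLetter i a ∷ w)
replaceLeftmostL-notLeft w [] la rewrite la = refl
replaceLeftmostL-notLeft w (l ∷ ls) la rewrite l | replaceLeftmostL-notLeft w ls la = refl

replaceRightmostR-notRight : ∀ {i T} → All (NotRight i) T → replaceRightmostR i T ≡ nothing
replaceRightmostR-notRight [] = refl
replaceRightmostR-notRight (r ∷ rs) rewrite replaceRightmostR-notRight rs | r = refl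

replaceRightmostR-last : ∀ {i z T} W → Right i z → All (NotRight i) T →
  replaceRightmostR i (W ++ z ∷ T) ≡ just (W ++ eLetter i z ∷ T)
replaceRightmostR-last []      rz rT rewrite replaceRightmostR-notRight rT | rz = refl
replaceRightmostR-last (_ ∷ W) rz rT rewrite replaceRightmostR-last W rz rT = refl

fq-leftmost : ∀ {i P a w} → All (NotLeft i) P → Left i a → All (NotRight i) w →
  fq i (P ++ a ∷ w) ≡ just (P ++ fLetter i a ∷ w)
fq-leftmost {i} {P} {a} {w} lP la rw
  rewrite hasInv-notLeft-++ (a ∷ w) lP | hasInv-notRight (left⇒notRight i la ∷ rw)
  = replaceLeftmostL-notLeft w lP la

eq-rightmost : ∀ {i W z T} → All (NotLeft i) W → Right i z → All (NotRight i) T →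
  eq i (W ++ z ∷ T) ≡ just (W ++ eLetter i z ∷ T)
eq-rightmost {i} {W} {z} {T} lW rz rT
  rewrite hasInv-notLeft-++ (z ∷ T) lW | right⇒notLeft i rz | hasInv-notRight rT
  = replaceRightmostR-last W rz rT

iter : {A : Set} → (A → Maybe A) → ℕ → A → Maybe A
iter op zero    a = just a
iter op (suc n) a = op a >>= iter op n

iter-sucʳ : ∀ {A : Set} (op : A → Maybe A) n a → iter op (suc n) a ≡ (iter op n a >>= op)
iter-sucʳ op zero a with op a
... | just _  = refl
... | nothing = refl
iter-sucʳ op (suc n) a with op a
... | just b  = iter-sucʳ op n b
... | nothing = refl

fq-iterate : ∀ {i a} n P w → All (NotLeft i) P → Left i a → All (NotRight i) w →
  iter (fq i) n (P ++ replicate n a ++ w) ≡ just (P ++ replicate n (fLetter i a) ++ w)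
fq-iterate zero P w _ _ _ = refl
fq-iterate {i} {a} (suc n) P w lP la rw = begin
    iter (fq i) (suc n) (P ++ a ∷ replicate n a ++ w)
  ≡⟨ cong (_>>= iter (fq i) n) (fq-leftmost lP la (++⁺ (replicate⁺ n (left⇒notRight i la)) rw)) ⟩
    iter (fq i) n (P ++ fa ∷ replicate n a ++ w)
  ≡⟨ cong (iter (fq i) n) (sym (∷ʳ-++ P fa _)) ⟩
    iter (fq i) n ((P ∷ʳ fa) ++ replicate n a ++ w)
  ≡⟨ fq-iterate n (P ∷ʳ fa) w (++⁺ lP (right⇒notLeft i (fLetter-right i a la) ∷ [])) la rw ⟩
    just ((P ∷ʳ fa) ++ replicate n fa ++ w)
  ≡⟨ cong just (∷ʳ-++ P fa _) ⟩
    just (P ++ replicate (suc n) fa ++ w) ∎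
  where fa = fLetter i a

eq-iterate : ∀ {i a} n W → All (NotLeft i) W → Right i a →
  iter (eq i) n (W ++ replicate n a) ≡ just (W ++ replicate n (eLetter i a))
eq-iterate zero W _ _ = refl
eq-iterate {i} {a} (suc n) W lW ra = begin
    iter (eq i) (suc n) (W ++ a ∷ replicate n a)
  ≡⟨ iter-sucʳ (eq i) n _ ⟩
    (iter (eq i) n (W ++ a ∷ replicate n a) >>= eq i)
  ≡⟨ cong (λ w → iter (eq i) n w >>= eq i) (sym (∷ʳ-++ W a _)) ⟩
    (iter (eq i) n ((W ∷ʳ a) ++ replicate n a) >>= eq i)
  ≡⟨ cong (_>>= eq i) (eq-iterate n (W ∷ʳ a) (++⁺ lW (right⇒notLeft i ra ∷ [])) ra) ⟩
    eq i ((W ∷ʳ a) ++ replicate n ea)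
  ≡⟨ cong (eq i) (∷ʳ-++ W a _) ⟩
    eq i (W ++ a ∷ replicate n ea)
  ≡⟨ eq-rightmost lW ra (replicate⁺ n (left⇒notRight i (eLetter-left i a ra))) ⟩
    just (W ++ replicate (suc n) ea) ∎
  where ea = eLetter i a

data Operator : Set where
  raise lower : Idx → Operator

apply : Operator → Word → Maybe Word
apply (raise i) = eq i
apply (lower i) = fq i

apply-step : ∀ o {x y} → apply o x ≡ just y → Step x y
apply-step (raise i) e = i , inj₁ e
apply-step (lower i) e = i , inj₂ e

hypoIso-apply : ∀ {u v ψ} → HypoIso u v ψ →
  ∀ o x → InComp u x → apply o (ψ x) ≡ Maybe.map ψ (apply o x)
hypoIso-apply H (raise i) = HypoIso.comm-e H i
hypoIso-apply H (lower i) = HypoIso.comm-f H i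

inversionAfter : Idx → Operator → ℕ → Word → Maybe Bool
inversionAfter j o n w = Maybe.map (hasInv j) (iter (apply o) n w)

hypoIso-inversionAfter : ∀ {u v ψ} → HypoIso u v ψ →
  ∀ j o n → inversionAfter j o n v ≡ inversionAfter j o n u
hypoIso-inversionAfter {u} {ψ = ψ} H j o n =
  subst (λ w → inversionAfter j o n w ≡ inversionAfter j o n u) base (transport n u ε)
  where
  open HypoIso H
  transport : ∀ n x → InComp u x → inversionAfter j o n (ψ x) ≡ inversionAfter j o n x
  transport zero    x c = cong just (εq-hasInv {j} {ψ x} {x} (pres-ε j x c))
  transport (suc n) x c rewrite hypoIso-apply H o x c with apply o x in e
  ... | nothing = refl
  ... | just x′ = transport n x′ (c ◅◅ (apply-step o e ◅ ε))

record FirstInversionAt (j : Idx) (o : Operator) (w : Word) (a : ℕ) : Set where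
  constructor firstInversionAt
  field
    hit    : inversionAfter j o (suc a) w ≡ just true
    before : ∀ n → n < a → inversionAfter j o (suc n) w ≡ just false

∼̈-firstInversionAt : ∀ {u v j o a b} → u ∼̈ v →
  FirstInversionAt j o u a → FirstInversionAt j o v b → a ≡ b
∼̈-firstInversionAt {j = j} {o} {a} {b} (_ , H)
  (firstInversionAt hitᵤ beforeᵤ) (firstInversionAt hitᵥ beforeᵥ) with <-cmp a b
... | tri< a<b _ _ = contradiction
  (trans (sym hitᵤ) (trans (sym (hypoIso-inversionAfter H j o (suc a))) (beforeᵥ a a<b))) λ ()
... | tri≈ _ a≡b _ = a≡b
... | tri> _ _ b<a = contradiction
  (trans (sym hitᵥ) (trans (hypoIso-inversionAfter H j o (suc b)) (beforeᵤ b b<a))) λ ()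

∼̈-wt : ∀ {u v} → u ∼̈ v → wt u ≡ wt v
∼̈-wt (ψ , H) = trans (sym (pres-wt _ ε)) (cong wt base)
  where open HypoIso H

lower₁-noInversionBefore : ∀ n m {T} → All (Left i1) T →
  inversionAfter i2 (lower i1) (suc n) (replicate (suc n) c2b ++ replicate m c2b ++ c1 ∷ c2b ∷ T)
    ≡ just false
lower₁-noInversionBefore n m {T} lT = trans
  (cong (Maybe.map (hasInv i2))
        (fq-iterate {a = c2b} (suc n) [] W [] refl (All.map (left⇒notRight i1) lW)))
  (cong just (hasInv-notLeft (++⁺ (replicate⁺ {x = c1b} (suc n) refl) (All.map left₁⇒notLeft₂ lW))))
  where
  W = replicate m c2b ++ c1 ∷ c2b ∷ T
  lW : All (Left i1) W
  lW = ++⁺ (replicate⁺ m refl) (refl ∷ refl ∷ lT)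

lower₁-firstInversionAt : ∀ a {T} → All (Left i1) T →
  FirstInversionAt i2 (lower i1) (replicate a c2b ++ c1 ∷ c2b ∷ T) a
lower₁-firstInversionAt a {T} lT = firstInversionAt hit before
  where
  reach : iter (fq i1) (suc a) (replicate a c2b ++ c1 ∷ c2b ∷ T)
          ≡ just (replicate a c1b ++ c2 ∷ c2b ∷ T)
  reach = begin
      iter (fq i1) (suc a) (replicate a c2b ++ c1 ∷ c2b ∷ T)
    ≡⟨ iter-sucʳ (fq i1) a _ ⟩
      (iter (fq i1) a (replicate a c2b ++ c1 ∷ c2b ∷ T) >>= fq i1)
    ≡⟨ cong (_>>= fq i1) (fq-iterate {a = c2b} a [] (c1 ∷ c2b ∷ T) [] refl
                            (All.map (left⇒notRight i1) (refl ∷ refl ∷ lT))) ⟩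
      fq i1 (replicate a c1b ++ c1 ∷ c2b ∷ T)
    ≡⟨ fq-leftmost (replicate⁺ a refl) refl (All.map (left⇒notRight i1) (refl ∷ lT)) ⟩
      just (replicate a c1b ++ c2 ∷ c2b ∷ T) ∎
  hit : inversionAfter i2 (lower i1) (suc a) (replicate a c2b ++ c1 ∷ c2b ∷ T) ≡ just true
  hit = trans (cong (Maybe.map (hasInv i2)) reach)
              (cong just (hasInv-adjacent (replicate a c1b) T refl refl))
  before : ∀ n → n < a →
    inversionAfter i2 (lower i1) (suc n) (replicate a c2b ++ c1 ∷ c2b ∷ T) ≡ just false
  before n n<a with m≤n⇒∃[o]m+o≡n n<a
  ... | m , sn+m≡a = subst (λ w → inversionAfter i2 (lower i1) (suc n) w ≡ just false)
    (begin
      replicate (suc n) c2b ++ replicate m c2b ++ c1 ∷ c2b ∷ T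
    ≡⟨ sym (++-assoc (replicate (suc n) c2b) _ _) ⟩
      (replicate (suc n) c2b ++ replicate m c2b) ++ c1 ∷ c2b ∷ T
    ≡⟨ cong (_++ c1 ∷ c2b ∷ T) (sym (replicate-+ (suc n) m c2b)) ⟩
      replicate (suc n + m) c2b ++ c1 ∷ c2b ∷ T
    ≡⟨ cong (λ k → replicate k c2b ++ c1 ∷ c2b ∷ T) sn+m≡a ⟩
      replicate a c2b ++ c1 ∷ c2b ∷ T ∎)
    (lower₁-noInversionBefore n m lT)

raise₁-noInversionBefore : ∀ n m {P} → All (Right i1) P →
  inversionAfter i2 (raise i1) (suc n) ((P ++ c2 ∷ c1b ∷ replicate m c2) ++ replicate (suc n) c2)
    ≡ just false
raise₁-noInversionBefore n m {P} rP = trans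
  (cong (Maybe.map (hasInv i2)) (eq-iterate (suc n) W (All.map (right⇒notLeft i1) rW) refl))
  (cong just (hasInv-notRight (++⁺ (All.map right₁⇒notRight₂ rW) (replicate⁺ {x = c1} (suc n) refl))))
  where
  W = P ++ c2 ∷ c1b ∷ replicate m c2
  rW : All (Right i1) W
  rW = ++⁺ rP (refl ∷ refl ∷ replicate⁺ m refl)

raise₁-firstInversionAt : ∀ a {P} → All (Right i1) P →
  FirstInversionAt i2 (raise i1) (P ++ c2 ∷ c1b ∷ replicate a c2) a
raise₁-firstInversionAt a {P} rP = firstInversionAt hit before
  where
  reach : iter (eq i1) (suc a) (P ++ c2 ∷ c1b ∷ replicate a c2)
          ≡ just ((P ∷ʳ c2) ++ c2b ∷ replicate a c1)
  reach = begin
      iter (eq i1) (suc a) (P ++ c2 ∷ c1b ∷ replicate a c2)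
    ≡⟨ iter-sucʳ (eq i1) a _ ⟩
      (iter (eq i1) a (P ++ c2 ∷ c1b ∷ replicate a c2) >>= eq i1)
    ≡⟨ cong (λ w → iter (eq i1) a w >>= eq i1) (sym (++-assoc P (c2 ∷ c1b ∷ []) _)) ⟩
      (iter (eq i1) a ((P ++ c2 ∷ c1b ∷ []) ++ replicate a c2) >>= eq i1)
    ≡⟨ cong (_>>= eq i1) (eq-iterate a (P ++ c2 ∷ c1b ∷ [])
                            (All.map (right⇒notLeft i1) (++⁺ rP (refl ∷ refl ∷ []))) refl) ⟩
      eq i1 ((P ++ c2 ∷ c1b ∷ []) ++ replicate a c1)
    ≡⟨ cong (eq i1) (trans (++-assoc P _ _) (sym (∷ʳ-++ P c2 _))) ⟩
      eq i1 ((P ∷ʳ c2) ++ c1b ∷ replicate a c1)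
    ≡⟨ eq-rightmost (All.map (right⇒notLeft i1) (++⁺ rP (refl ∷ []))) refl (replicate⁺ a refl) ⟩
      just ((P ∷ʳ c2) ++ c2b ∷ replicate a c1) ∎
  hit : inversionAfter i2 (raise i1) (suc a) (P ++ c2 ∷ c1b ∷ replicate a c2) ≡ just true
  hit = trans (cong (Maybe.map (hasInv i2)) reach)
              (cong just (trans (cong (hasInv i2) (∷ʳ-++ P c2 _)) (hasInv-adjacent P _ refl refl)))
  before : ∀ n → n < a →
    inversionAfter i2 (raise i1) (suc n) (P ++ c2 ∷ c1b ∷ replicate a c2) ≡ just false
  before n n<a with m≤n⇒∃[o]m+o≡n n<a
  ... | m , sn+m≡a = subst (λ w → inversionAfter i2 (raise i1) (suc n) w ≡ just false)
    (begin
      (P ++ c2 ∷ c1b ∷ replicate m c2) ++ replicate (suc n) c2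
    ≡⟨ ++-assoc P _ _ ⟩
      P ++ c2 ∷ c1b ∷ replicate m c2 ++ replicate (suc n) c2
    ≡⟨ cong (λ r → P ++ c2 ∷ c1b ∷ r) (sym (replicate-+ m (suc n) c2)) ⟩
      P ++ c2 ∷ c1b ∷ replicate (m + suc n) c2
    ≡⟨ cong (λ k → P ++ c2 ∷ c1b ∷ replicate k c2) (trans (+-comm m (suc n)) sn+m≡a) ⟩
      P ++ c2 ∷ c1b ∷ replicate a c2 ∎)
    (raise₁-noInversionBefore n m rP)

only : ∀ {k} → Fin k → C2 → Fin k → Word
only y c = updateAt (const []) y (const (c ∷ []))

pointSubst : ∀ {k} → Fin k → Word → Fin k → C2 → Fin k → Word
pointSubst x p y c = updateAt (only y c) x (const p)

updateAt-All : ∀ {k} {P : C2 → Set} (σ : Fin k → Word) x p →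
  (∀ z → All P (σ z)) → All P p → ∀ z → All P (updateAt σ x (const p) z)
updateAt-All {P = P} σ x p Pσ Pp z with z ≟ x
... | yes refl = subst (All P) (sym (updateAt-updates x σ)) Pp
... | no z≢x  = subst (All P) (sym (updateAt-minimal z x σ z≢x)) (Pσ z)

extend-pointSubst-All : ∀ {k} {P : C2 → Set} (x : Fin k) p y c → All P p → P c →
  ∀ w → All P (extend (pointSubst x p y c) w)
extend-pointSubst-All x p y c Pp Pc w =
  concat⁺ (map⁺ (All.universal (updateAt-All _ x p (updateAt-All _ y _ (λ _ → []) (Pc ∷ [])) Pp) w))

extend-updateAt-fresh : ∀ {k} (σ : Fin k → Word) x f w → ∣ w ∣X x ≡ 0 →
  extend (updateAt σ x f) w ≡ extend σ w
extend-updateAt-fresh σ x f []      _ = refl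
extend-updateAt-fresh σ x f (z ∷ w) h with x ≟ z
... | no x≢z = cong₂ _++_ (updateAt-minimal z x σ (x≢z ∘ sym)) (extend-updateAt-fresh σ x f w h)
extend-updateAt-fresh σ x f (z ∷ w) () | yes _

extend-only : ∀ {k} (y : Fin k) c w → extend (only y c) w ≡ replicate (∣ w ∣X y) c
extend-only y c []      = refl
extend-only y c (z ∷ w) with y ≟ z
... | yes refl = cong₂ _++_ (updateAt-updates y (const [])) (extend-only y c w)
... | no y≢z   = cong₂ _++_ (updateAt-minimal z y (const []) (y≢z ∘ sym)) (extend-only y c w)

extend-pointSubst-fresh : ∀ {k} (x : Fin k) p y c w → ∣ w ∣X x ≡ 0 →
  extend (pointSubst x p y c) w ≡ replicate (∣ w ∣X y) c
extend-pointSubst-fresh x p y c w h =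
  trans (extend-updateAt-fresh (only y c) x (const p) w h) (extend-only y c w)

extend-pointSubst-split : ∀ {k} (x : Fin k) p y c w₁ w₂ →
  extend (pointSubst x p y c) (w₁ ++ x ∷ w₂)
    ≡ extend (pointSubst x p y c) w₁ ++ p ++ extend (pointSubst x p y c) w₂
extend-pointSubst-split x p y c w₁ w₂ =
  trans (concatMap-++ (pointSubst x p y c) w₁ (x ∷ w₂))
        (cong (λ q → extend (pointSubst x p y c) w₁ ++ q ++ extend (pointSubst x p y c) w₂)
              (updateAt-updates x (only y c)))

wt₁-replicate-c1 : ∀ n → proj₁ (wt (replicate n c1)) ≡ + n
wt₁-replicate-c1 n
  rewrite occ-replicate _≟C_ c1 n | occ-replicate-≢ _≟C_ {c1b} {c1} n (λ ()) = ℤ.+-identityʳ (+ n)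

wt₁-extend-only : ∀ {k} (x : Fin k) w → proj₁ (wt (extend (only x c1) w)) ≡ + ∣ w ∣X x
wt₁-extend-only x w = trans (cong (proj₁ ∘ wt) (extend-only x c1 w)) (wt₁-replicate-c1 (∣ w ∣X x))

prefix-firstInversionAt : ∀ {k} (x y : Fin k) w₁ w₂ → ∣ w₁ ∣X x ≡ 0 →
  FirstInversionAt i2 (lower i1)
    (extend (pointSubst x (c1 ∷ c2b ∷ []) y c2b) (w₁ ++ x ∷ w₂)) (∣ w₁ ∣X y)
prefix-firstInversionAt x y w₁ w₂ fresh =
  subst (λ w → FirstInversionAt i2 (lower i1) w (∣ w₁ ∣X y)) (sym image)
    (lower₁-firstInversionAt (∣ w₁ ∣X y) (extend-pointSubst-All x _ y c2b (refl ∷ refl ∷ []) refl w₂))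
  where
  σ = pointSubst x (c1 ∷ c2b ∷ []) y c2b
  image : extend σ (w₁ ++ x ∷ w₂) ≡ replicate (∣ w₁ ∣X y) c2b ++ c1 ∷ c2b ∷ extend σ w₂
  image = trans (extend-pointSubst-split x _ y c2b w₁ w₂)
                (cong (_++ c1 ∷ c2b ∷ extend σ w₂) (extend-pointSubst-fresh x _ y c2b w₁ fresh))

suffix-firstInversionAt : ∀ {k} (x y : Fin k) w₁ w₂ → ∣ w₂ ∣X x ≡ 0 →
  FirstInversionAt i2 (raise i1)
    (extend (pointSubst x (c2 ∷ c1b ∷ []) y c2) (w₁ ++ x ∷ w₂)) (∣ w₂ ∣X y)
suffix-firstInversionAt x y w₁ w₂ fresh =
  subst (λ w → FirstInversionAt i2 (raise i1) w (∣ w₂ ∣X y)) (sym image)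
    (raise₁-firstInversionAt (∣ w₂ ∣X y) (extend-pointSubst-All x _ y c2 (refl ∷ refl ∷ []) refl w₁))
  where
  σ = pointSubst x (c2 ∷ c1b ∷ []) y c2
  image : extend σ (w₁ ++ x ∷ w₂) ≡ extend σ w₁ ++ c2 ∷ c1b ∷ replicate (∣ w₂ ∣X y) c2
  image = trans (extend-pointSubst-split x _ y c2 w₁ w₂)
                (cong (λ r → extend σ w₁ ++ c2 ∷ c1b ∷ r) (extend-pointSubst-fresh x _ y c2 w₂ fresh))

theorem9p31 : (k : ℕ) (u v : List (Fin k)) → HypoSatisfies u v →
    (∀ x → ∣ u ∣X x ≡ ∣ v ∣X x)
  × (∀ x (u₁ u₂ v₁ v₂ : List (Fin k)) → u ≡ u₁ ++ x ∷ u₂ → v ≡ v₁ ++ x ∷ v₂ →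
       ∣ u₁ ∣X x ≡ 0 → ∣ v₁ ∣X x ≡ 0 → ∀ y → ∣ u₁ ∣X y ≡ ∣ v₁ ∣X y)
  × (∀ x (u₁ u₂ v₁ v₂ : List (Fin k)) → u ≡ u₁ ++ x ∷ u₂ → v ≡ v₁ ++ x ∷ v₂ →
       ∣ u₂ ∣X x ≡ 0 → ∣ v₂ ∣X x ≡ 0 → ∀ y → ∣ u₂ ∣X y ≡ ∣ v₂ ∣X y)
theorem9p31 k u v hypo = counts , prefixes , suffixes
  where
  counts : ∀ x → ∣ u ∣X x ≡ ∣ v ∣X x
  counts x = ℤ.+-injective (begin
    + ∣ u ∣X x                        ≡⟨ sym (wt₁-extend-only x u) ⟩
    proj₁ (wt (extend (only x c1) u)) ≡⟨ cong proj₁ (∼̈-wt (hypo (only x c1))) ⟩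
    proj₁ (wt (extend (only x c1) v)) ≡⟨ wt₁-extend-only x v ⟩
    + ∣ v ∣X x                        ∎)
  prefixes : ∀ x (u₁ u₂ v₁ v₂ : List (Fin k)) → u ≡ u₁ ++ x ∷ u₂ → v ≡ v₁ ++ x ∷ v₂ →
    ∣ u₁ ∣X x ≡ 0 → ∣ v₁ ∣X x ≡ 0 → ∀ y → ∣ u₁ ∣X y ≡ ∣ v₁ ∣X y
  prefixes x u₁ u₂ v₁ v₂ refl refl u₁-fresh v₁-fresh y =
    ∼̈-firstInversionAt (hypo (pointSubst x (c1 ∷ c2b ∷ []) y c2b))
      (prefix-firstInversionAt x y u₁ u₂ u₁-fresh) (prefix-firstInversionAt x y v₁ v₂ v₁-fresh)
  suffixes : ∀ x (u₁ u₂ v₁ v₂ : List (Fin k)) → u ≡ u₁ ++ x ∷ u₂ → v ≡ v₁ ++ x ∷ v₂ →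
    ∣ u₂ ∣X x ≡ 0 → ∣ v₂ ∣X x ≡ 0 → ∀ y → ∣ u₂ ∣X y ≡ ∣ v₂ ∣X y
  suffixes x u₁ u₂ v₁ v₂ refl refl u₂-fresh v₂-fresh y =
    ∼̈-firstInversionAt (hypo (pointSubst x (c2 ∷ c1b ∷ []) y c2))
      (suffix-firstInversionAt x y u₁ u₂ u₂-fresh) (suffix-firstInversionAt x y v₁ v₂ v₂-fresh)
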